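{- Let $N$ be a positive integer and let $\mathbf{F}$ be a positive frieze over $\tfrac1N\mathbb{Z}$ of width $n$. Let $\mathbf{M}$ be the unique bi-infinite tame $\mathrm{SL}_2$-tiling (indexed by $\mathbb{Z}\times\mathbb{Z}$) extending $\mathbf{F}$, and let $N\mathbf{M}$ be the integer $N^2$-tiling obtained by multiplying every entry of $\mathbf{M}$ by $N$. Then the tameness parameters $(K,L,R,S)$ of $N\mathbf{M}$ satisfy $L=1$ and $R=S$.
   Context: A rational frieze of width $n$ is a function $(i,j)\mapsto m_{ij}\in\mathbb{Q}$ on $\{(i,j)\in\mathbb{Z}^2:0\le i-j\le n\}$ with $m_{i,i}=m_{i+n,i}=0$, $m_{i+1,i}=m_{i+n,i+1}=1$ for all $i$, and $m_{i,j}m_{i+1,j+1}-m_{i,j+1}m_{i+1,j}=1$ for $0<i-j<n$; positive if all nonzero entries are positive; over $\tfrac1N\mathbb{Z}$ if all entries lie in $\tfrac1N\mathbb{Z}$. Such a positive frieze extends uniquely to $\mathbf{M}\colon\mathbb{Z}\times\mathbb{Z}\to\mathbb{Q}$ in which every contiguous $2\times2$ subblock has determinant $1$ and every contiguous $3\times3$ subblock has determinant $0$, with $m_{i+n,j}=m_{i,j+n}=-m_{ij}$. For an integer $N'\neq0$, an $N'$-tiling is an integer array with every contiguous $2\times2$ subblock of determinant $N'$; it is tame if all contiguous $3\times3$ subblocks have determinant $0$. Tameness parameters (for $N'>0$): $K$ = gcd of all entries; with $2\times2$ minors $m_{ij}m_{i'j'}-m_{ij'}m_{i'j}$ ($i<i'$,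 $j<j'$), $t$ = gcd of all minors, $r$ = gcd of minors from two consecutive columns, $s$ = gcd of minors from two consecutive rows; $R=N'/r$, $S=N'/s$, $L=t/K^2$. -}

module Defs where

open import Data.Nat as ℕ using (ℕ)
open import Data.Integer as ℤ using (ℤ; +_)
open import Data.Integer.Divisibility using (_∣_)
open import Data.Rational as ℚ using (ℚ; 0ℚ; 1ℚ; _/_)
open import Data.Product using (Σ; ∃; _×_)
open import Relation.Binary.PropositionalEquality using (_≡_; _≢_)

ι : ℤ → ℚ
ι z = z / 1

InRegion : ℕ → ℤ → ℤ → Set
InRegion n i j = (+ 0 ℤ.≤ i ℤ.- j) × (i ℤ.- j ℤ.≤ + n)

-- A rational frieze of width n (only values on the region matter)
record IsFrieze (n : ℕ) (m : ℤ → ℤ → ℚ) : Set where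
  field
    diag0   : ∀ i → m i i ≡ 0ℚ
    top0    : ∀ i → m (i ℤ.+ + n) i ≡ 0ℚ
    sub1    : ∀ i → m (i ℤ.+ + 1) i ≡ 1ℚ
    sup1    : ∀ i → m (i ℤ.+ + n) (i ℤ.+ + 1) ≡ 1ℚ
    unimod  : ∀ i j → + 0 ℤ.< i ℤ.- j → i ℤ.- j ℤ.< + n →
              m i j ℚ.* m (i ℤ.+ + 1) (j ℤ.+ + 1)
                ℚ.- m i (j ℤ.+ + 1) ℚ.* m (i ℤ.+ + 1) j ≡ 1ℚ

IsPositiveFrieze : ℕ → (ℤ → ℤ → ℚ) → Set
IsPositiveFrieze n m =
  IsFrieze n m × (∀ i j → InRegion n i j → m i j ≢ 0ℚ → 0ℚ ℚ.< m i j)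

Over1/N : (N n : ℕ) → (ℤ → ℤ → ℚ) → Set
Over1/N N n m = ∀ i j → InRegion n i j → ∃ λ (z : ℤ) → ι (+ N) ℚ.* m i j ≡ ι z

det2 : (ℤ → ℤ → ℚ) → ℤ → ℤ → ℚ
det2 M i j = M i j ℚ.* M (i ℤ.+ + 1) (j ℤ.+ + 1) ℚ.- M i (j ℤ.+ + 1) ℚ.* M (i ℤ.+ + 1) j

det3 : (ℤ → ℤ → ℚ) → ℤ → ℤ → ℚ
det3 M i j =
  (a ℚ.* (e ℚ.* k ℚ.- f ℚ.* h) ℚ.- b ℚ.* (d ℚ.* k ℚ.- f ℚ.* g)) ℚ.+ c ℚ.* (d ℚ.* h ℚ.- e ℚ.* g)
  where
    i1 = i ℤ.+ + 1
    i2 = i ℤ.+ + 2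
    j1 = j ℤ.+ + 1
    j2 = j ℤ.+ + 2
    a = M i j
    b = M i j1
    c = M i j2
    d = M i1 j
    e = M i1 j1
    f = M i1 j2
    g = M i2 j
    h = M i2 j1
    k = M i2 j2

record IsTameExtension (n : ℕ) (m M : ℤ → ℤ → ℚ) : Set where
  field
    extends  : ∀ i j → InRegion n i j → M i j ≡ m i j
    sl2      : ∀ i j → det2 M i j ≡ 1ℚ
    tame     : ∀ i j → det3 M i j ≡ 0ℚ
    antiRow  : ∀ i j → M (i ℤ.+ + n) j ≡ ℚ.- M i j
    antiCol  : ∀ i j → M i (j ℤ.+ + n) ≡ ℚ.- M i j

minor : (ℤ → ℤ → ℤ) → ℤ → ℤ → ℤ → ℤ → ℤ
minor A i i' j j' = A i j ℤ.* A i' j' ℤ.- A i j' ℤ.* A i' j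

IsGcdOf : (ℤ → Set) → ℕ → Set
IsGcdOf P g = (∀ x → P x → + g ∣ x) × (∀ d → (∀ x → P x → d ∣ x) → d ∣ + g)

Entry : (ℤ → ℤ → ℤ) → ℤ → Set
Entry A x = ∃ λ i → ∃ λ j → x ≡ A i j

Minor : (ℤ → ℤ → ℤ) → ℤ → Set
Minor A x = ∃ λ i → ∃ λ i' → ∃ λ j → ∃ λ j' →
  (i ℤ.< i') × (j ℤ.< j') × (x ≡ minor A i i' j j')

ColMinor : (ℤ → ℤ → ℤ) → ℤ → Set
ColMinor A x = ∃ λ i → ∃ λ i' → ∃ λ j →
  (i ℤ.< i') × (x ≡ minor A i i' j (j ℤ.+ + 1))

RowMinor : (ℤ → ℤ → ℤ) → ℤ → Set
RowMinor A x = ∃ λ i → ∃ λ j → ∃ λ j' →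
  (j ℤ.< j') × (x ≡ minor A i (i ℤ.+ + 1) j j')

-- K, t, r, s are gcds; L = t / K², R = N' / r, S = N' / s are rationals,
-- given by their defining equations L·K² = t, R·r = N', S·s = N'.
record TamenessParams (N' : ℕ) (A : ℤ → ℤ → ℤ) (K : ℕ) (L R S : ℚ) : Set where
  field
    t r s : ℕ
    K-gcd : IsGcdOf (Entry A) K
    t-gcd : IsGcdOf (Minor A) t
    r-gcd : IsGcdOf (ColMinor A) r
    s-gcd : IsGcdOf (RowMinor A) s
    L-def : L ℚ.* ι (+ (K ℕ.* K)) ≡ ι (+ t)
    R-def : R ℚ.* ι (+ r) ≡ ι (+ N')
    S-def : S ℚ.* ι (+ s) ≡ ι (+ N')

{-# OPTIONS --safe #-}
module Submission where

-- The tame SL₂ conditions, together with M i i = 0 and M (i+1) i = 1, force all rows and all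
-- columns of M to satisfy the same three-term recurrence u k - a k u (k+1) + u (k+2) = 0 with the
-- quiddity a k = M (k+2) k.  A solution is determined by two consecutive values, so both sides of
--   M i j M i' j' - M i j' M i' j = M j' j M i' i                       (Ptolemy)
-- agree as functions of i' (and, for i' = i+1, of j').  After scaling by N, every 2×2 minor of NM
-- is thus a product of two entries and, NM being antisymmetric, every product of two entries is a
-- minor up to sign; hence t = K².  Minors on two consecutive columns, and on two consecutive rows,
-- are both exactly the numbers N · NM p q with q < p; hence r = s.

open import Defs
open import Data.Nat as ℕ using (ℕ)
open import Data.Integer as ℤ using (ℤ; +_)
open import Data.Rational as ℚ using (ℚ; 1ℚ)
open import Data.Product using (_×_)
open import Relation.Binary.PropositionalEquality using (_≡_)

open import Algebra.Properties.Group using (x∙y⁻¹≈ε⇒x≈y)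
open import Data.Empty using (⊥; ⊥-elim)
open import Data.Integer using (-[1+_])
import Data.Integer.Properties as ℤP
import Data.Integer.Tactic.RingSolver as ℤ-Ring
open import Data.List using (_∷_; [])
open import Data.Nat.Coprimality using (coprime-/gcd; coprime-divisor)
open import Data.Nat.Divisibility
  using (_∣_; ∣-antisym; 0∣⇒≡0; _∣0; ∣n⇒∣m*n; *-pres-∣; *-monoˡ-∣; *-cancelʳ-∣)
open import Data.Nat.DivMod using (_/_; m/n*n≡m)
open import Data.Nat.GCD using (gcd; gcd[m,n]∣m; gcd[m,n]∣n; gcd[m,n]≡0⇒m≡0; gcd[m,n]≡0⇒n≡0)
import Data.Nat.Properties as ℕP
import Data.Nat.Tactic.RingSolver as ℕ-Ring
open import Data.Product using (∃; _,_; proj₁; proj₂)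
open import Data.Rational using (0ℚ; _+_; _-_; _*_; -_; 1/_)
open import Data.Rational.Literals using (fromℤ)
import Data.Rational.Properties as ℚP
open import Data.Sum using (_⊎_; inj₁; inj₂)
open import Function using (_∘_)
open import Level using (0ℓ)
open import Relation.Binary.Definitions using (tri<; tri≈; tri>)
open import Relation.Binary.PropositionalEquality
  using (_≢_; refl; sym; trans; cong; cong₂; subst; subst₂; module ≡-Reasoning)
open import Relation.Nullary.Decidable using (dec⇒maybe)
open import Tactic.RingSolver using (solve-∀; solve)
open import Tactic.RingSolver.Core.AlmostCommutativeRing
  using (AlmostCommutativeRing; fromCommutativeRing)

open ≡-Reasoning

ℚ-ring : AlmostCommutativeRing 0ℓ 0ℓ
ℚ-ring = fromCommutativeRing ℚP.+-*-commutativeRing (λ x → dec⇒maybe (0ℚ ℚP.≟ x))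

+1+1≡+2 : ∀ k → k ℤ.+ + 1 ℤ.+ + 1 ≡ k ℤ.+ + 2
+1+1≡+2 k = ℤP.+-assoc k (+ 1) (+ 1)

ℤ-induction : (P : ℤ → Set) (k₀ : ℤ) → P k₀ →
              (∀ k → P k → P (k ℤ.+ + 1)) → (∀ k → P (k ℤ.+ + 1) → P k) → ∀ k → P k
ℤ-induction P k₀ base up down k = subst P (k₀+[k-k₀]≡k k₀ k) (from-offset (k ℤ.- k₀))
  where
  k₀+[k-k₀]≡k : ∀ k₀ k → k₀ ℤ.+ (k ℤ.- k₀) ≡ k
  k₀+[k-k₀]≡k = solve-∀ ℤ-Ring.ring

  offset-suc : ∀ d → P (k₀ ℤ.+ d) → P (k₀ ℤ.+ (d ℤ.+ + 1))
  offset-suc d = subst P (ℤP.+-assoc k₀ d (+ 1)) ∘ up (k₀ ℤ.+ d)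

  offset-pred : ∀ d → P (k₀ ℤ.+ (d ℤ.+ + 1)) → P (k₀ ℤ.+ d)
  offset-pred d = down (k₀ ℤ.+ d) ∘ subst P (sym (ℤP.+-assoc k₀ d (+ 1)))

  at-origin : P (k₀ ℤ.+ + 0)
  at-origin = subst P (sym (ℤP.+-identityʳ k₀)) base

  from-offset : ∀ d → P (k₀ ℤ.+ d)
  from-offset (+ 0)              = at-origin
  from-offset (+ ℕ.suc m)        =
    subst (λ n → P (k₀ ℤ.+ + n)) (ℕP.+-comm m 1) (offset-suc (+ m) (from-offset (+ m)))
  from-offset -[1+ 0 ]           = offset-pred -[1+ 0 ] at-origin
  from-offset -[1+ ℕ.suc m ]     = offset-pred -[1+ ℕ.suc m ] (from-offset -[1+ m ])

ℤ-induction₂ : (P : ℤ → Set) (k₀ : ℤ) → P k₀ → P (k₀ ℤ.+ + 1) →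
               (∀ k → P k → P (k ℤ.+ + 1) → P (k ℤ.+ + 2)) →
               (∀ k → P (k ℤ.+ + 1) → P (k ℤ.+ + 2) → P k) → ∀ k → P k
ℤ-induction₂ P k₀ p₀ p₁ up down =
  proj₁ ∘ ℤ-induction (λ k → P k × P (k ℤ.+ + 1)) k₀ (p₀ , p₁)
    (λ k (p , q) → q , subst P (sym (+1+1≡+2 k)) (up k p q))
    (λ k (q , r) → down k q (subst P (+1+1≡+2 k) r) , q)

-- Three-term recurrences

record Recurrent (a u : ℤ → ℚ) : Set where
  constructor recurrent
  field
    recurrence : ∀ k → u k - a k * u (k ℤ.+ + 1) + u (k ℤ.+ + 2) ≡ 0ℚ

module _ {a : ℤ → ℚ} where

  recurrent-vanishing : ∀ {u} → Recurrent a u →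
                        ∀ k₀ → u k₀ ≡ 0ℚ → u (k₀ ℤ.+ + 1) ≡ 0ℚ → ∀ k → u k ≡ 0ℚ
  recurrent-vanishing {u} (recurrent rec) k₀ u-k₀≡0 u-k₀+1≡0 =
    ℤ-induction₂ (λ k → u k ≡ 0ℚ) k₀ u-k₀≡0 u-k₀+1≡0 forward backward
    where
    forward : ∀ k → u k ≡ 0ℚ → u (k ℤ.+ + 1) ≡ 0ℚ → u (k ℤ.+ + 2) ≡ 0ℚ
    forward k u₀ u₁ = begin
      u (k ℤ.+ + 2)                                  ≡⟨ drop-zeros (a k) (u (k ℤ.+ + 2)) ⟨
      0ℚ - a k * 0ℚ + u (k ℤ.+ + 2)                   ≡⟨ cong₂ (λ x y → x - a k * y + u (k ℤ.+ + 2)) u₀ u₁ ⟨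
      u k - a k * u (k ℤ.+ + 1) + u (k ℤ.+ + 2)       ≡⟨ rec k ⟩
      0ℚ                                             ∎
      where
      drop-zeros : ∀ b y → 0ℚ - b * 0ℚ + y ≡ y
      drop-zeros = solve-∀ ℚ-ring

    backward : ∀ k → u (k ℤ.+ + 1) ≡ 0ℚ → u (k ℤ.+ + 2) ≡ 0ℚ → u k ≡ 0ℚ
    backward k u₁ u₂ = begin
      u k                                            ≡⟨ drop-zeros (a k) (u k) ⟨
      u k - a k * 0ℚ + 0ℚ                             ≡⟨ cong₂ (λ x y → u k - a k * x + y) u₁ u₂ ⟨
      u k - a k * u (k ℤ.+ + 1) + u (k ℤ.+ + 2)       ≡⟨ rec k ⟩
      0ℚ                                             ∎
      where
      drop-zeros : ∀ b x → x - b * 0ℚ + 0ℚ ≡ x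
      drop-zeros = solve-∀ ℚ-ring

  recurrent-*ˡ : ∀ {u} b → Recurrent a u → Recurrent a (λ k → b * u k)
  recurrent-*ˡ {u} b (recurrent rec) = recurrent λ k → begin
    b * u k - a k * (b * u (k ℤ.+ + 1)) + b * u (k ℤ.+ + 2)  ≡⟨ factor b (u k) (a k) (u (k ℤ.+ + 1)) (u (k ℤ.+ + 2)) ⟩
    b * (u k - a k * u (k ℤ.+ + 1) + u (k ℤ.+ + 2))          ≡⟨ cong (b *_) (rec k) ⟩
    b * 0ℚ                                                ≡⟨ ℚP.*-zeroʳ b ⟩
    0ℚ                                                    ∎
    where
    factor : ∀ b x c y z → b * x - c * (b * y) + b * z ≡ b * (x - c * y + z)
    factor = solve-∀ ℚ-ring

  recurrent-*ʳ : ∀ {u} b → Recurrent a u → Recurrent a (λ k → u k * b)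
  recurrent-*ʳ {u} b (recurrent rec) = recurrent λ k → begin
    u k * b - a k * (u (k ℤ.+ + 1) * b) + u (k ℤ.+ + 2) * b  ≡⟨ factor b (u k) (a k) (u (k ℤ.+ + 1)) (u (k ℤ.+ + 2)) ⟩
    (u k - a k * u (k ℤ.+ + 1) + u (k ℤ.+ + 2)) * b          ≡⟨ cong (_* b) (rec k) ⟩
    0ℚ * b                                                ≡⟨ ℚP.*-zeroˡ b ⟩
    0ℚ                                                    ∎
    where
    factor : ∀ b x c y z → x * b - c * (y * b) + z * b ≡ (x - c * y + z) * b
    factor = solve-∀ ℚ-ring

  recurrent-sub : ∀ {u v} → Recurrent a u → Recurrent a v → Recurrent a (λ k → u k - v k)
  recurrent-sub {u} {v} (recurrent rec-u) (recurrent rec-v) = recurrent step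
    where
    step : ∀ k → (u k - v k) - a k * (u (k ℤ.+ + 1) - v (k ℤ.+ + 1)) + (u (k ℤ.+ + 2) - v (k ℤ.+ + 2)) ≡ 0ℚ
    step k = begin
      (u₀ - v₀) - a k * (u₁ - v₁) + (u₂ - v₂)                ≡⟨ regroup u₀ u₁ u₂ v₀ v₁ v₂ (a k) ⟩
      (u₀ - a k * u₁ + u₂) - (v₀ - a k * v₁ + v₂)            ≡⟨ cong₂ _-_ (rec-u k) (rec-v k) ⟩
      0ℚ - 0ℚ                                               ≡⟨⟩
      0ℚ                                                    ∎
      where
      u₀ u₁ u₂ v₀ v₁ v₂ : ℚ
      u₀ = u k ; u₁ = u (k ℤ.+ + 1) ; u₂ = u (k ℤ.+ + 2)
      v₀ = v k ; v₁ = v (k ℤ.+ + 1) ; v₂ = v (k ℤ.+ + 2)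
      regroup : ∀ u₀ u₁ u₂ v₀ v₁ v₂ c →
                (u₀ - v₀) - c * (u₁ - v₁) + (u₂ - v₂) ≡ (u₀ - c * u₁ + u₂) - (v₀ - c * v₁ + v₂)
      regroup = solve-∀ ℚ-ring

  recurrent-unique : ∀ {u v} → Recurrent a u → Recurrent a v →
                     ∀ k₀ → u k₀ ≡ v k₀ → u (k₀ ℤ.+ + 1) ≡ v (k₀ ℤ.+ + 1) → ∀ k → u k ≡ v k
  recurrent-unique {u} {v} rec-u rec-v k₀ e₀ e₁ k =
    x∙y⁻¹≈ε⇒x≈y ℚP.+-0-group (u k) (v k)
      (recurrent-vanishing (recurrent-sub rec-u rec-v) k₀ (difference-zero e₀) (difference-zero e₁) k)
    where
    difference-zero : ∀ {x y} → x ≡ y → x - y ≡ 0ℚ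
    difference-zero {x} refl = ℚP.+-inverseʳ x

-- Tame SL₂-tilings

record IsTameSL₂ (M : ℤ → ℤ → ℚ) : Set where
  field
    sl2  : ∀ i j → det2 M i j ≡ 1ℚ
    tame : ∀ i j → det3 M i j ≡ 0ℚ

transpose : (ℤ → ℤ → ℚ) → ℤ → ℤ → ℚ
transpose M i j = M j i

transpose-isTameSL₂ : ∀ {M} → IsTameSL₂ M → IsTameSL₂ (transpose M)
transpose-isTameSL₂ {M} T = record
  { sl2  = λ i j → trans (swap-last (M j i) (M (j ℤ.+ + 1) (i ℤ.+ + 1)) (M (j ℤ.+ + 1) i) (M j (i ℤ.+ + 1))) (sl2 j i)
  ; tame = λ i j → trans (det3-transpose (M j i) (M j (i ℤ.+ + 1)) (M j (i ℤ.+ + 2))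
                                         (M (j ℤ.+ + 1) i) (M (j ℤ.+ + 1) (i ℤ.+ + 1)) (M (j ℤ.+ + 1) (i ℤ.+ + 2))
                                         (M (j ℤ.+ + 2) i) (M (j ℤ.+ + 2) (i ℤ.+ + 1)) (M (j ℤ.+ + 2) (i ℤ.+ + 2)))
                         (tame j i)
  }
  where
  open IsTameSL₂ T
  swap-last : ∀ a b c d → a * b - c * d ≡ a * b - d * c
  swap-last = solve-∀ ℚ-ring
  det3-transpose : ∀ a b c d e f g h k →
    (a * (e * k - h * f) - d * (b * k - h * c)) + g * (b * f - e * c) ≡
    (a * (e * k - f * h) - b * (d * k - f * g)) + c * (d * h - e * g)
  det3-transpose = solve-∀ ℚ-ring

-- Replacing row k + 2 by (row k) - γ (row k + 1) + (row k + 2) leaves det3 M k j unchanged;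
-- expanding along the new row, the two outer cofactors are unit 2×2 minors.
row-defect-recurrent :
  ∀ {M} → IsTameSL₂ M →
  ∀ k γ → Recurrent (λ j → M k j * M (k ℤ.+ + 1) (j ℤ.+ + 2) - M k (j ℤ.+ + 2) * M (k ℤ.+ + 1) j)
                    (λ j → M k j - γ * M (k ℤ.+ + 1) j + M (k ℤ.+ + 2) j)
row-defect-recurrent {M} T k γ = recurrent step
  where
  open IsTameSL₂ T
  k₁ k₂ : ℤ
  k₁ = k ℤ.+ + 1 ; k₂ = k ℤ.+ + 2

  defect : ℤ → ℚ
  defect x = M k x - γ * M k₁ x + M k₂ x

  step : ∀ j → defect j - (M k j * M k₁ (j ℤ.+ + 2) - M k (j ℤ.+ + 2) * M k₁ j) * defect (j ℤ.+ + 1)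
                 + defect (j ℤ.+ + 2) ≡ 0ℚ
  step j = begin
    e₀ - Y * e₁ + e₂                   ≡⟨ unit-cofactors e₀ e₁ e₂ X Y (det2 M k j) X≡1 (sl2 k j) ⟨
    e₀ * X - e₁ * Y + e₂ * det2 M k j  ≡⟨ row-operation a b c d e f g h i γ ⟨
    det3 M k j                         ≡⟨ tame k j ⟩
    0ℚ                                 ∎
    where
    j₁ j₂ : ℤ
    j₁ = j ℤ.+ + 1 ; j₂ = j ℤ.+ + 2
    a b c d e f g h i e₀ e₁ e₂ X Y : ℚ
    a = M k j  ; b = M k j₁  ; c = M k j₂
    d = M k₁ j ; e = M k₁ j₁ ; f = M k₁ j₂
    g = M k₂ j ; h = M k₂ j₁ ; i = M k₂ j₂
    e₀ = defect j ; e₁ = defect j₁ ; e₂ = defect j₂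
    X = b * f - c * e
    Y = a * f - c * d

    X≡1 : X ≡ 1ℚ
    X≡1 = subst (λ j₂ → M k j₁ * M k₁ j₂ - M k j₂ * M k₁ j₁ ≡ 1ℚ) (+1+1≡+2 j) (sl2 k j₁)

    row-operation : ∀ a b c d e f g h i γ →
      (a * (e * i - f * h) - b * (d * i - f * g)) + c * (d * h - e * g) ≡
      (a - γ * d + g) * (b * f - c * e) - (b - γ * e + h) * (a * f - c * d) + (c - γ * f + i) * (a * e - b * d)
    row-operation = solve-∀ ℚ-ring

    unit-cofactors : ∀ e₀ e₁ e₂ X Y Z → X ≡ 1ℚ → Z ≡ 1ℚ → e₀ * X - e₁ * Y + e₂ * Z ≡ e₀ - Y * e₁ + e₂
    unit-cofactors e₀ e₁ e₂ X Y Z refl refl = solve (e₀ ∷ e₁ ∷ e₂ ∷ Y ∷ []) ℚ-ring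

three-term-cong : ∀ {p p′ r r′ t t′} q → p ≡ p′ → r ≡ r′ → t ≡ t′ → p - q * r + t ≡ p′ - q * r′ + t′
three-term-cong q refl refl refl = refl

module NormalisedTiling {M : ℤ → ℤ → ℚ} (T : IsTameSL₂ M)
                        (diag : ∀ i → M i i ≡ 0ℚ) (subdiag : ∀ i → M (i ℤ.+ + 1) i ≡ 1ℚ) where
  open IsTameSL₂ T

  superdiag : ∀ i → M i (i ℤ.+ + 1) ≡ - 1ℚ
  superdiag i = begin
    M i i₁                            ≡⟨ solve-for x ⟩
    - (0ℚ * 0ℚ - x * 1ℚ)              ≡⟨ cong₂ (λ p q → - (p * q - x * 1ℚ)) (diag i) (diag i₁) ⟨
    - (M i i * M i₁ i₁ - x * 1ℚ)      ≡⟨ cong (λ p → - (M i i * M i₁ i₁ - x * p)) (subdiag i) ⟨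
    - det2 M i i                      ≡⟨ cong -_ (sl2 i i) ⟩
    - 1ℚ                              ∎
    where
    i₁ : ℤ
    i₁ = i ℤ.+ + 1
    x : ℚ
    x = M i i₁
    solve-for : ∀ x → x ≡ - (0ℚ * 0ℚ - x * 1ℚ)
    solve-for = solve-∀ ℚ-ring

  subdiag₂ : ∀ k → M (k ℤ.+ + 2) (k ℤ.+ + 1) ≡ 1ℚ
  subdiag₂ k = subst (λ r → M r (k ℤ.+ + 1) ≡ 1ℚ) (+1+1≡+2 k) (subdiag (k ℤ.+ + 1))

  superdiag₂ : ∀ k → M (k ℤ.+ + 1) (k ℤ.+ + 2) ≡ - 1ℚ
  superdiag₂ k = subst (λ r → M (k ℤ.+ + 1) r ≡ - 1ℚ) (+1+1≡+2 k) (superdiag (k ℤ.+ + 1))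

  quiddity : ℤ → ℚ
  quiddity k = M (k ℤ.+ + 2) k

  column-relation : ∀ k x → M k x - quiddity k * M (k ℤ.+ + 1) x + M (k ℤ.+ + 2) x ≡ 0ℚ
  column-relation k = recurrent-vanishing (row-defect-recurrent T k q) k at-k at-k+1
    where
    q : ℚ
    q = quiddity k
    at-k : M k k - q * M (k ℤ.+ + 1) k + q ≡ 0ℚ
    at-k = begin
      M k k - q * M (k ℤ.+ + 1) k + q  ≡⟨ three-term-cong q (diag k) (subdiag k) (refl {x = q}) ⟩
      0ℚ - q * 1ℚ + q                  ≡⟨ cancel q ⟩
      0ℚ                               ∎
      where
      cancel : ∀ q → 0ℚ - q * 1ℚ + q ≡ 0ℚ
      cancel = solve-∀ ℚ-ring
    at-k+1 : M k (k ℤ.+ + 1) - q * M (k ℤ.+ + 1) (k ℤ.+ + 1) + M (k ℤ.+ + 2) (k ℤ.+ + 1) ≡ 0ℚ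
    at-k+1 = begin
      M k (k ℤ.+ + 1) - q * M (k ℤ.+ + 1) (k ℤ.+ + 1) + M (k ℤ.+ + 2) (k ℤ.+ + 1)
        ≡⟨ three-term-cong q (superdiag k) (diag (k ℤ.+ + 1)) (subdiag₂ k) ⟩
      - 1ℚ - q * 0ℚ + 1ℚ  ≡⟨ cancel q ⟩
      0ℚ                  ∎
      where
      cancel : ∀ q → - 1ℚ - q * 0ℚ + 1ℚ ≡ 0ℚ
      cancel = solve-∀ ℚ-ring

  row-relation : ∀ k x → M x k - quiddity k * M x (k ℤ.+ + 1) + M x (k ℤ.+ + 2) ≡ 0ℚ
  row-relation k =
    recurrent-vanishing (row-defect-recurrent (transpose-isTameSL₂ T) k q) (k ℤ.+ + 1) at-k+1
      (subst (λ r → M r k - q * M r (k ℤ.+ + 1) + M r (k ℤ.+ + 2) ≡ 0ℚ) (sym (+1+1≡+2 k)) at-k+2)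
    where
    q : ℚ
    q = quiddity k
    at-k+1 : M (k ℤ.+ + 1) k - q * M (k ℤ.+ + 1) (k ℤ.+ + 1) + M (k ℤ.+ + 1) (k ℤ.+ + 2) ≡ 0ℚ
    at-k+1 = begin
      M (k ℤ.+ + 1) k - q * M (k ℤ.+ + 1) (k ℤ.+ + 1) + M (k ℤ.+ + 1) (k ℤ.+ + 2)
        ≡⟨ three-term-cong q (subdiag k) (diag (k ℤ.+ + 1)) (superdiag₂ k) ⟩
      1ℚ - q * 0ℚ + - 1ℚ  ≡⟨ cancel q ⟩
      0ℚ                  ∎
      where
      cancel : ∀ q → 1ℚ - q * 0ℚ + - 1ℚ ≡ 0ℚ
      cancel = solve-∀ ℚ-ring
    at-k+2 : M (k ℤ.+ + 2) k - q * M (k ℤ.+ + 2) (k ℤ.+ + 1) + M (k ℤ.+ + 2) (k ℤ.+ + 2) ≡ 0ℚ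
    at-k+2 = begin
      q - q * M (k ℤ.+ + 2) (k ℤ.+ + 1) + M (k ℤ.+ + 2) (k ℤ.+ + 2)
        ≡⟨ three-term-cong q (refl {x = q}) (subdiag₂ k) (diag (k ℤ.+ + 2)) ⟩
      q - q * 1ℚ + 0ℚ     ≡⟨ cancel q ⟩
      0ℚ                  ∎
      where
      cancel : ∀ q → q - q * 1ℚ + 0ℚ ≡ 0ℚ
      cancel = solve-∀ ℚ-ring

  columns-recurrent : ∀ x → Recurrent quiddity (λ k → M k x)
  columns-recurrent x = recurrent λ k → column-relation k x

  rows-recurrent : ∀ x → Recurrent quiddity (M x)
  rows-recurrent x = recurrent λ k → row-relation k x

  ptolemy-adjacent : ∀ i j j′ → M i j * M (i ℤ.+ + 1) j′ - M i j′ * M (i ℤ.+ + 1) j ≡ M j′ j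
  ptolemy-adjacent i j =
    recurrent-unique
      (recurrent-sub (recurrent-*ˡ (M i j) (rows-recurrent (i ℤ.+ + 1)))
                   (recurrent-*ʳ (M (i ℤ.+ + 1) j) (rows-recurrent i)))
      (columns-recurrent j) j
      (trans (ℚP.+-inverseʳ (M i j * M (i ℤ.+ + 1) j)) (sym (diag j)))
      (trans (sl2 i j) (sym (subdiag j)))

  ptolemy : ∀ i i′ j j′ → M i j * M i′ j′ - M i j′ * M i′ j ≡ M j′ j * M i′ i
  ptolemy i i′ j j′ =
    recurrent-unique
      (recurrent-sub (recurrent-*ˡ (M i j) (columns-recurrent j′)) (recurrent-*ˡ (M i j′) (columns-recurrent j)))
      (recurrent-*ˡ (M j′ j) (columns-recurrent i)) i at-i at-i+1 i′
    where
    at-i : M i j * M i j′ - M i j′ * M i j ≡ M j′ j * M i i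
    at-i = begin
      M i j * M i j′ - M i j′ * M i j  ≡⟨ cong (λ z → M i j * M i j′ - z) (ℚP.*-comm (M i j′) (M i j)) ⟩
      M i j * M i j′ - M i j * M i j′  ≡⟨ ℚP.+-inverseʳ (M i j * M i j′) ⟩
      0ℚ                               ≡⟨ ℚP.*-zeroʳ (M j′ j) ⟨
      M j′ j * 0ℚ                      ≡⟨ cong (M j′ j *_) (diag i) ⟨
      M j′ j * M i i                   ∎
    at-i+1 : M i j * M (i ℤ.+ + 1) j′ - M i j′ * M (i ℤ.+ + 1) j ≡ M j′ j * M (i ℤ.+ + 1) i
    at-i+1 = begin
      M i j * M (i ℤ.+ + 1) j′ - M i j′ * M (i ℤ.+ + 1) j  ≡⟨ ptolemy-adjacent i j j′ ⟩
      M j′ j                                             ≡⟨ ℚP.*-identityʳ (M j′ j) ⟨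
      M j′ j * 1ℚ                                        ≡⟨ cong (M j′ j *_) (subdiag i) ⟨
      M j′ j * M (i ℤ.+ + 1) i                           ∎

  antisymmetric : ∀ i j → M j i ≡ - M i j
  antisymmetric i j = begin
    M j i                                                ≡⟨ ℚP.*-identityˡ (M j i) ⟨
    1ℚ * M j i                                           ≡⟨ cong (_* M j i) (subdiag j) ⟨
    M (j ℤ.+ + 1) j * M j i                              ≡⟨ ptolemy i j j (j ℤ.+ + 1) ⟨
    M i j * M j (j ℤ.+ + 1) - M i (j ℤ.+ + 1) * M j j    ≡⟨ cong₂ (λ p r → M i j * p - M i (j ℤ.+ + 1) * r)
                                                                   (superdiag j) (diag j) ⟩
    M i j * - 1ℚ - M i (j ℤ.+ + 1) * 0ℚ                  ≡⟨ simplify (M i j) (M i (j ℤ.+ + 1)) ⟩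
    - M i j                                              ∎
    where
    simplify : ∀ x y → x * - 1ℚ - y * 0ℚ ≡ - x
    simplify = solve-∀ ℚ-ring

ι≡fromℤ : ∀ x → ι x ≡ fromℤ x
ι≡fromℤ x = ℚP.↥p/↧p≡p (fromℤ x)

ι-injective : ∀ {x y} → ι x ≡ ι y → x ≡ y
ι-injective {x} {y} eq = cong ℚ.↥_ (trans (sym (ι≡fromℤ x)) (trans eq (ι≡fromℤ y)))

-- fromℤ x * fromℤ y computes to (x ℤ.* y) / 1.
ι-* : ∀ x y → ι (x ℤ.* y) ≡ ι x * ι y
ι-* x y = sym (cong₂ _*_ (ι≡fromℤ x) (ι≡fromℤ y))

ι-+ : ∀ x y → ι (x ℤ.+ y) ≡ ι x + ι y
ι-+ x y = begin
  (x ℤ.+ y) ℚ./ 1                         ≡⟨ cong (ℚ._/ 1) (cong₂ ℤ._+_ (ℤP.*-identityʳ x) (ℤP.*-identityʳ y)) ⟨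
  (x ℤ.* + 1 ℤ.+ y ℤ.* + 1) ℚ./ 1          ≡⟨⟩
  fromℤ x + fromℤ y                       ≡⟨ cong₂ _+_ (ι≡fromℤ x) (ι≡fromℤ y) ⟨
  ι x + ι y                               ∎

ι-neg : ∀ x → ι (ℤ.- x) ≡ - ι x
ι-neg x = begin
  ι (ℤ.- x)       ≡⟨ ι≡fromℤ (ℤ.- x) ⟩
  fromℤ (ℤ.- x)   ≡⟨ fromℤ-neg x ⟩
  - fromℤ x       ≡⟨ cong -_ (ι≡fromℤ x) ⟨
  - ι x           ∎
  where
  fromℤ-neg : ∀ x → fromℤ (ℤ.- x) ≡ - fromℤ x
  fromℤ-neg (+ 0)       = refl
  fromℤ-neg (+ ℕ.suc n) = refl
  fromℤ-neg -[1+ n ]    = refl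

ι-minor : ∀ A i i′ j j′ → ι (minor A i i′ j j′) ≡ ι (A i j) * ι (A i′ j′) - ι (A i j′) * ι (A i′ j)
ι-minor A i i′ j j′ = begin
  ι (A i j ℤ.* A i′ j′ ℤ.+ ℤ.- (A i j′ ℤ.* A i′ j))      ≡⟨ ι-+ (A i j ℤ.* A i′ j′) (ℤ.- (A i j′ ℤ.* A i′ j)) ⟩
  ι (A i j ℤ.* A i′ j′) + ι (ℤ.- (A i j′ ℤ.* A i′ j))    ≡⟨ cong (λ z → ι (A i j ℤ.* A i′ j′) + z) (ι-neg (A i j′ ℤ.* A i′ j)) ⟩
  ι (A i j ℤ.* A i′ j′) - ι (A i j′ ℤ.* A i′ j)          ≡⟨ cong₂ _-_ (ι-* (A i j) (A i′ j′)) (ι-* (A i j′) (A i′ j)) ⟩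
  ι (A i j) * ι (A i′ j′) - ι (A i j′) * ι (A i′ j)      ∎

*-cancelʳ-ι : ∀ {p q} m .{{_ : ℕ.NonZero m}} → p * ι (+ m) ≡ q * ι (+ m) → p ≡ q
*-cancelʳ-ι {p} {q} m eq = begin
  p                  ≡⟨ ℚP.*-identityʳ p ⟨
  p * 1ℚ             ≡⟨ cong (p *_) (ℚP.*-inverseʳ x) ⟨
  p * (x * 1/ x)     ≡⟨ ℚP.*-assoc p x (1/ x) ⟨
  p * x * 1/ x       ≡⟨ cong (_* 1/ x) eq′ ⟩
  q * x * 1/ x       ≡⟨ ℚP.*-assoc q x (1/ x) ⟩
  q * (x * 1/ x)     ≡⟨ cong (q *_) (ℚP.*-inverseʳ x) ⟩
  q * 1ℚ             ≡⟨ ℚP.*-identityʳ q ⟩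
  q                  ∎
  where
  x : ℚ
  x = fromℤ (+ m)
  eq′ : p * x ≡ q * x
  eq′ = subst (λ y → p * y ≡ q * y) (ι≡fromℤ (+ m)) eq

module ScaledTiling {M : ℤ → ℤ → ℚ} (T : IsTameSL₂ M)
                    (diag : ∀ i → M i i ≡ 0ℚ) (subdiag : ∀ i → M (i ℤ.+ + 1) i ≡ 1ℚ)
                    {N : ℕ} {A : ℤ → ℤ → ℤ} (A≡N*M : ∀ i j → ι (A i j) ≡ ι (+ N) * M i j) where
  open NormalisedTiling T diag subdiag

  ptolemyℤ : ∀ i i′ j j′ → minor A i i′ j j′ ≡ A j′ j ℤ.* A i′ i
  ptolemyℤ i i′ j j′ = ι-injective (begin
    ι (minor A i i′ j j′)                                    ≡⟨ ι-minor A i i′ j j′ ⟩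
    ι (A i j) * ι (A i′ j′) - ι (A i j′) * ι (A i′ j)        ≡⟨ cong₂ _-_ (cong₂ _*_ (A≡N*M i j) (A≡N*M i′ j′))
                                                                         (cong₂ _*_ (A≡N*M i j′) (A≡N*M i′ j)) ⟩
    n * M i j * (n * M i′ j′) - n * M i j′ * (n * M i′ j)    ≡⟨ factor n (M i j) (M i′ j′) (M i j′) (M i′ j) ⟩
    n * n * (M i j * M i′ j′ - M i j′ * M i′ j)              ≡⟨ cong (n * n *_) (ptolemy i i′ j j′) ⟩
    n * n * (M j′ j * M i′ i)                                ≡⟨ distribute n (M j′ j) (M i′ i) ⟩
    n * M j′ j * (n * M i′ i)                                ≡⟨ cong₂ _*_ (A≡N*M j′ j) (A≡N*M i′ i) ⟨
    ι (A j′ j) * ι (A i′ i)                                  ≡⟨ ι-* (A j′ j) (A i′ i) ⟨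
    ι (A j′ j ℤ.* A i′ i)                                    ∎)
    where
    n : ℚ
    n = ι (+ N)
    factor : ∀ n a b c d → n * a * (n * b) - n * c * (n * d) ≡ n * n * (a * b - c * d)
    factor = solve-∀ ℚ-ring
    distribute : ∀ n a b → n * n * (a * b) ≡ n * a * (n * b)
    distribute = solve-∀ ℚ-ring

  antisymmetricℤ : ∀ i j → A j i ≡ ℤ.- A i j
  antisymmetricℤ i j = ι-injective (begin
    ι (A j i)            ≡⟨ A≡N*M j i ⟩
    n * M j i            ≡⟨ cong (n *_) (antisymmetric i j) ⟩
    n * - M i j          ≡⟨ ℚP.neg-distribʳ-* n (M i j) ⟨
    - (n * M i j)        ≡⟨ cong -_ (A≡N*M i j) ⟨
    - ι (A i j)          ≡⟨ ι-neg (A i j) ⟨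
    ι (ℤ.- A i j)        ∎)
    where
    n : ℚ
    n = ι (+ N)

  diagℤ : ∀ i → A i i ≡ + 0
  diagℤ i = ι-injective (trans (A≡N*M i i) (trans (cong (ι (+ N) *_) (diag i)) (ℚP.*-zeroʳ (ι (+ N)))))

  subdiagℤ : ∀ i → A (i ℤ.+ + 1) i ≡ + N
  subdiagℤ i = ι-injective (trans (A≡N*M (i ℤ.+ + 1) i)
                                  (trans (cong (ι (+ N) *_) (subdiag i)) (ℚP.*-identityʳ (ι (+ N)))))

-- Greatest common divisors of sets of integers

IsGcdOf-unique : ∀ {P Q : ℤ → Set} {g h} → (∀ x → P x → Q x) → (∀ x → Q x → P x) →
                 IsGcdOf P g → IsGcdOf Q h → g ≡ h
IsGcdOf-unique P⊆Q Q⊆P (g∣P , g-greatest) (h∣Q , h-greatest) =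
  ∣-antisym (h-greatest (+ _) λ x Qx → g∣P x (Q⊆P x Qx)) (g-greatest (+ _) λ x Px → h∣Q x (P⊆Q x Px))

IsGcdOf-≢0 : ∀ {P : ℤ → Set} {g x} → IsGcdOf P g → P x → ℤ.∣ x ∣ ≢ 0 → g ≢ 0
IsGcdOf-≢0 {x = x} (g∣P , _) Px ∣x∣≢0 refl = ∣x∣≢0 (0∣⇒≡0 (g∣P x Px))

-- Dividing out e = gcd d a leaves d / e coprime to a / e, so d / e divides every element of P.
∣*-all⇒∣*gcd : ∀ {P : ℤ → Set} {g} → IsGcdOf P g →
               ∀ d a → (∀ x → P x → d ∣ a ℕ.* ℤ.∣ x ∣) → d ∣ a ℕ.* g
∣*-all⇒∣*gcd {P} {g} (_ , g-greatest) d a d∣a*P with gcd d a in e≡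
... | 0 = subst₂ (λ d a → d ∣ a ℕ.* g) (sym (gcd[m,n]≡0⇒m≡0 e≡)) (sym (gcd[m,n]≡0⇒n≡0 d e≡)) (0 ∣0)
... | ℕ.suc _ = subst₂ _∣_ (d′*e≡d) a′*g*e≡a*g (*-monoˡ-∣ e (∣n⇒∣m*n a′ d′∣g))
  where
  e : ℕ
  e = gcd d a
  instance
    e≢0 : ℕ.NonZero e
    e≢0 = subst ℕ.NonZero (sym e≡) _
  d′ a′ : ℕ
  d′ = d / e
  a′ = a / e
  d′*e≡d : d′ ℕ.* e ≡ d
  d′*e≡d = m/n*n≡m (gcd[m,n]∣m d a)
  a′*e≡a : a′ ℕ.* e ≡ a
  a′*e≡a = m/n*n≡m (gcd[m,n]∣n d a)
  swap : ∀ a′ e y → a′ ℕ.* e ℕ.* y ≡ a′ ℕ.* y ℕ.* e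
  swap = solve-∀ ℕ-Ring.ring
  a′*g*e≡a*g : a′ ℕ.* g ℕ.* e ≡ a ℕ.* g
  a′*g*e≡a*g = trans (sym (swap a′ e g)) (cong (ℕ._* g) a′*e≡a)
  d′∣P : ∀ x → P x → d′ ∣ ℤ.∣ x ∣
  d′∣P x Px = coprime-divisor (coprime-/gcd d a) (*-cancelʳ-∣ e
    (subst₂ _∣_ (sym d′*e≡d) (trans (cong (ℕ._* ℤ.∣ x ∣) (sym a′*e≡a)) (swap a′ e ℤ.∣ x ∣)) (d∣a*P x Px)))
  d′∣g : d′ ∣ g
  d′∣g = g-greatest (+ d′) d′∣P

module IntegerPtolemy {N : ℕ} {A : ℤ → ℤ → ℤ}
                      (ptolemy : ∀ i i′ j j′ → minor A i i′ j j′ ≡ A j′ j ℤ.* A i′ i)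
                      (antisymmetric : ∀ i j → A j i ≡ ℤ.- A i j) (diag : ∀ i → A i i ≡ + 0)
                      (subdiag : ∀ i → A (i ℤ.+ + 1) i ≡ + N) where

  entry-zero-or-below-diagonal :
    ∀ p q → A p q ≡ + 0 ⊎ ∃ λ P → ∃ λ Q → Q ℤ.< P × ℤ.∣ A p q ∣ ≡ ℤ.∣ A P Q ∣
  entry-zero-or-below-diagonal p q with ℤP.<-cmp p q
  ... | tri< p<q _ _  = inj₂ (q , p , p<q , trans (cong ℤ.∣_∣ (antisymmetric q p)) (ℤP.∣-i∣≡∣i∣ (A q p)))
  ... | tri≈ _ refl _ = inj₁ (diag p)
  ... | tri> _ _ q<p  = inj₂ (p , q , q<p , refl)

  minor-gcd-∣-entry-products : ∀ {t} → IsGcdOf (Minor A) t →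
                               ∀ p q p′ q′ → t ∣ ℤ.∣ A p q ∣ ℕ.* ℤ.∣ A p′ q′ ∣
  minor-gcd-∣-entry-products {t} (t∣minors , _) p q p′ q′
    with entry-zero-or-below-diagonal p q | entry-zero-or-below-diagonal p′ q′
  ... | inj₁ Apq≡0 | _ = subst (λ z → t ∣ ℤ.∣ z ∣ ℕ.* ℤ.∣ A p′ q′ ∣) (sym Apq≡0) (t ∣0)
  ... | inj₂ _ | inj₁ Ap′q′≡0 =
    subst (λ z → t ∣ ℤ.∣ A p q ∣ ℕ.* ℤ.∣ z ∣) (sym Ap′q′≡0) (subst (t ∣_) (sym (ℕP.*-zeroʳ ℤ.∣ A p q ∣)) (t ∣0))
  ... | inj₂ (P , Q , Q<P , e) | inj₂ (P′ , Q′ , Q′<P′ , e′) =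
    subst (t ∣_) ∣minor∣≡ (t∣minors _ (Q , P , Q′ , P′ , Q<P , Q′<P′ , refl))
    where
    ∣minor∣≡ : ℤ.∣ minor A Q P Q′ P′ ∣ ≡ ℤ.∣ A p q ∣ ℕ.* ℤ.∣ A p′ q′ ∣
    ∣minor∣≡ = begin
      ℤ.∣ minor A Q P Q′ P′ ∣            ≡⟨ cong ℤ.∣_∣ (ptolemy Q P Q′ P′) ⟩
      ℤ.∣ A P′ Q′ ℤ.* A P Q ∣            ≡⟨ ℤP.∣i*j∣≡∣i∣*∣j∣ (A P′ Q′) (A P Q) ⟩
      ℤ.∣ A P′ Q′ ∣ ℕ.* ℤ.∣ A P Q ∣      ≡⟨ ℕP.*-comm ℤ.∣ A P′ Q′ ∣ ℤ.∣ A P Q ∣ ⟩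
      ℤ.∣ A P Q ∣ ℕ.* ℤ.∣ A P′ Q′ ∣      ≡⟨ cong₂ ℕ._*_ e e′ ⟨
      ℤ.∣ A p q ∣ ℕ.* ℤ.∣ A p′ q′ ∣      ∎

  minor-gcd≡entry-gcd² : ∀ {K t} → IsGcdOf (Entry A) K → IsGcdOf (Minor A) t → t ≡ K ℕ.* K
  minor-gcd≡entry-gcd² {K} {t} K-gcd t-gcd = ∣-antisym t∣K*K K*K∣t
    where
    t∣entry*K : ∀ p q → t ∣ ℤ.∣ A p q ∣ ℕ.* K
    t∣entry*K p q = ∣*-all⇒∣*gcd K-gcd t ℤ.∣ A p q ∣
      λ { _ (p′ , q′ , refl) → minor-gcd-∣-entry-products t-gcd p q p′ q′ }
    t∣K*K : t ∣ K ℕ.* K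
    t∣K*K = ∣*-all⇒∣*gcd K-gcd t K
      λ { _ (p , q , refl) → subst (t ∣_) (ℕP.*-comm ℤ.∣ A p q ∣ K) (t∣entry*K p q) }
    K*K∣t : K ℕ.* K ∣ t
    K*K∣t = proj₂ t-gcd (+ (K ℕ.* K)) λ { _ (i , i′ , j , j′ , _ , _ , refl) →
      subst (K ℕ.* K ∣_) (sym (trans (cong ℤ.∣_∣ (ptolemy i i′ j j′)) (ℤP.∣i*j∣≡∣i∣*∣j∣ (A j′ j) (A i′ i))))
        (*-pres-∣ (proj₁ K-gcd _ (j′ , j , refl)) (proj₁ K-gcd _ (i′ , i , refl))) }

  colMinor≡ : ∀ i i′ j → minor A i i′ j (j ℤ.+ + 1) ≡ + N ℤ.* A i′ i
  colMinor≡ i i′ j = trans (ptolemy i i′ j (j ℤ.+ + 1)) (cong (ℤ._* A i′ i) (subdiag j))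

  rowMinor≡ : ∀ i j j′ → minor A i (i ℤ.+ + 1) j j′ ≡ + N ℤ.* A j′ j
  rowMinor≡ i j j′ = trans (ptolemy i (i ℤ.+ + 1) j j′)
                           (trans (cong (A j′ j ℤ.*_) (subdiag i)) (ℤP.*-comm (A j′ j) (+ N)))

  colMinor-gcd≡rowMinor-gcd : ∀ {r s} → IsGcdOf (ColMinor A) r → IsGcdOf (RowMinor A) s → r ≡ s
  colMinor-gcd≡rowMinor-gcd = IsGcdOf-unique col⊆row row⊆col
    where
    col⊆row : ∀ x → ColMinor A x → RowMinor A x
    col⊆row _ (i , i′ , j , i<i′ , refl) = j , i , i′ , i<i′ , trans (colMinor≡ i i′ j) (sym (rowMinor≡ j i i′))
    row⊆col : ∀ x → RowMinor A x → ColMinor A x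
    row⊆col _ (i , j , j′ , j<j′ , refl) = j , j′ , i , j<j′ , trans (rowMinor≡ i j j′) (sym (colMinor≡ j j′ i))

  module _ .{{N≢0 : ℕ.NonZero N}} where

    entry-gcd≢0 : ∀ {K} → IsGcdOf (Entry A) K → K ≢ 0
    entry-gcd≢0 K-gcd = IsGcdOf-≢0 K-gcd (+ 1 , + 0 , sym (subdiag (+ 0))) (ℕ.≢-nonZero⁻¹ N)

    colMinor-gcd≢0 : ∀ {r} → IsGcdOf (ColMinor A) r → r ≢ 0
    colMinor-gcd≢0 r-gcd = IsGcdOf-≢0 r-gcd (+ 0 , + 1 , + 0 , ℤ.+<+ (ℕ.s≤s ℕ.z≤n) , refl)
      (subst (_≢ 0) (sym ∣minor∣≡N*N) (ℕ.≢-nonZero⁻¹ (N ℕ.* N) {{ℕP.m*n≢0 N N}}))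
      where
      ∣minor∣≡N*N : ℤ.∣ minor A (+ 0) (+ 1) (+ 0) (+ 1) ∣ ≡ N ℕ.* N
      ∣minor∣≡N*N = trans (cong ℤ.∣_∣ (trans (colMinor≡ (+ 0) (+ 1) (+ 0)) (cong (+ N ℤ.*_) (subdiag (+ 0)))))
                          (ℤP.∣i*j∣≡∣i∣*∣j∣ (+ N) (+ N))

-- For n = 0 the antiperiodicity M (i + n) j ≡ - M i j makes every row its own negative.
no-tame-extension-of-width-zero : ∀ {F M} → IsTameExtension 0 F M → ⊥
no-tame-extension-of-width-zero {M = M} ext = 1≢-1 (begin
  1ℚ                                          ≡⟨ sl2 i j ⟨
  M i j * M i₁ j₁ - M i j₁ * M i₁ j           ≡⟨ cong₂ (λ a b → a * M i₁ j₁ - b * M i₁ j) (self-negating i j) (self-negating i j₁) ⟩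
  - M i j * M i₁ j₁ - - M i j₁ * M i₁ j       ≡⟨ negate-row (M i j) (M i j₁) (M i₁ j) (M i₁ j₁) ⟩
  - (M i j * M i₁ j₁ - M i j₁ * M i₁ j)       ≡⟨ cong -_ (sl2 i j) ⟩
  - 1ℚ                                        ∎)
  where
  open IsTameExtension ext
  i j i₁ j₁ : ℤ
  i = + 0 ; j = + 0 ; i₁ = i ℤ.+ + 1 ; j₁ = j ℤ.+ + 1
  self-negating : ∀ i j → M i j ≡ - M i j
  self-negating i j = trans (cong (λ r → M r j) (sym (ℤP.+-identityʳ i))) (antiRow i j)
  negate-row : ∀ a b c d → - a * d - - b * c ≡ - (a * d - b * c)
  negate-row = solve-∀ ℚ-ring
  1≢-1 : 1ℚ ≢ - 1ℚ
  1≢-1 ()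

inRegion : ∀ {n} i j {d} → i ℤ.- j ≡ + d → d ℕ.≤ n → InRegion n i j
inRegion {n} _ _ i-j≡d d≤n = subst (λ x → + 0 ℤ.≤ x × x ℤ.≤ + n) (sym i-j≡d) (ℤ.+≤+ ℕ.z≤n , ℤ.+≤+ d≤n)

module TameExtension {n F M} (frieze : IsFrieze (ℕ.suc n) F) (ext : IsTameExtension (ℕ.suc n) F M) where
  open IsTameExtension ext

  isTameSL₂ : IsTameSL₂ M
  isTameSL₂ = record { sl2 = sl2 ; tame = tame }

  diag : ∀ i → M i i ≡ 0ℚ
  diag i = trans (extends i i (inRegion i i (ℤP.+-inverseʳ i) ℕ.z≤n)) (IsFrieze.diag0 frieze i)

  subdiag : ∀ i → M (i ℤ.+ + 1) i ≡ 1ℚ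
  subdiag i = trans (extends (i ℤ.+ + 1) i (inRegion (i ℤ.+ + 1) i (i+1-i≡1 i) (ℕ.s≤s ℕ.z≤n)))
                    (IsFrieze.sub1 frieze i)
    where
    i+1-i≡1 : ∀ i → i ℤ.+ + 1 ℤ.- i ≡ + 1
    i+1-i≡1 = solve-∀ ℤ-Ring.ring

lemma6p2 : (N : ℕ) → 0 ℕ.< N → (n : ℕ) → (F : ℤ → ℤ → ℚ) →
    IsPositiveFrieze n F → Over1/N N n F →
    (M : ℤ → ℤ → ℚ) → IsTameExtension n F M →
    (NM : ℤ → ℤ → ℤ) → (∀ i j → ι (NM i j) ≡ ι (+ N) ℚ.* M i j) →
    (K : ℕ) (L R S : ℚ) → TamenessParams (N ℕ.* N) NM K L R S →
    (L ≡ 1ℚ) × (R ≡ S)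
lemma6p2 _ _ 0 _ _ _ _ ext _ _ _ _ _ _ _ = ⊥-elim (no-tame-extension-of-width-zero ext)
lemma6p2 N 0<N (ℕ.suc n) F (frieze , _) _ M ext NM NM≡N*M K L R S params = L≡1 , R≡S
  where
  open TamenessParams params
  open TameExtension frieze ext
  open ScaledTiling isTameSL₂ diag subdiag {N} {NM} NM≡N*M
  open IntegerPtolemy {N} {NM} ptolemyℤ antisymmetricℤ diagℤ subdiagℤ

  instance
    N≢0 : ℕ.NonZero N
    N≢0 = ℕ.>-nonZero 0<N

  L≡1 : L ≡ 1ℚ
  L≡1 = *-cancelʳ-ι (K ℕ.* K) {{ℕP.m*n≢0 K K {{K≢0}} {{K≢0}}}}
          (trans L-def (trans (cong (λ x → ι (+ x)) (minor-gcd≡entry-gcd² K-gcd t-gcd)) (sym (ℚP.*-identityˡ _))))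
    where
    K≢0 : ℕ.NonZero K
    K≢0 = ℕ.≢-nonZero (entry-gcd≢0 K-gcd)

  R≡S : R ≡ S
  R≡S = *-cancelʳ-ι r {{ℕ.≢-nonZero (colMinor-gcd≢0 r-gcd)}}
          (trans R-def (trans (sym S-def) (cong (λ x → S * ι (+ x)) (sym (colMinor-gcd≡rowMinor-gcd r-gcd s-gcd)))))
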